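{- Let $n\geq 3$ and let $G$ be a graph with $G\to K_n$. If $V$ is a set of vertices of $G$ with $|V|\leq 2n-2$, then $G\setminus V\to K_{n-1}$.
   Context: All graphs are finite and simple. $G\to H$ means that every colouring of the edges of $G$ with two colours contains a monochromatic copy of $H$. $K_m$ denotes the complete graph on $m$ vertices. $G\setminus V$ is the subgraph of $G$ induced on the vertices not in $V$. -}

module Defs where

open import Data.Nat using (ℕ)
open import Data.Fin using (Fin)
open import Data.Fin.Subset using (Subset; _∉_)
open import Data.Bool using (Bool)
open import Data.Product using (Σ; _×_; ∃; proj₁)
open import Relation.Binary.PropositionalEquality using (_≡_; _≢_)
open import Relation.Nullary using (¬_)
open import Function.Definitions using (Injective)

record Graph (V : Set) : Set₁ where
  field
    Adj   : V → V → Set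
    sym   : ∀ {x y} → Adj x y → Adj y x
    irrefl : ∀ {x} → ¬ Adj x x
open Graph public

FinGraph : ℕ → Set₁
FinGraph m = Graph (Fin m)

-- A 2-colouring of the edges: a symmetric colour assignment to pairs of
-- vertices (only its values on edges matter).
record Colouring (V : Set) : Set where
  field
    col    : V → V → Bool
    col-sym : ∀ x y → col x y ≡ col y x
open Colouring public

MonoK : {V : Set} → Graph V → Colouring V → ℕ → Set
MonoK {V} G c k =
  Σ Bool λ b → Σ (Fin k → V) λ f →
    Injective _≡_ _≡_ f ×
    (∀ i j → i ≢ j → Adj G (f i) (f j) × col c (f i) (f j) ≡ b)

_⟶K_ : {V : Set} → Graph V → ℕ → Set
_⟶K_ {V} G k = (c : Colouring V) → MonoK G c k

Remaining : {m : ℕ} → Subset m → Set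
Remaining {m} S = Σ (Fin m) λ x → x ∉ S

_∖_ : {m : ℕ} → FinGraph m → (S : Subset m) → Graph (Remaining S)
G ∖ S = record
  { Adj = λ x y → Adj G (proj₁ x) (proj₁ y)
  ; sym = sym G
  ; irrefl = irrefl G
  }

module Submission where

-- Write N = n - 1, so |S| ≤ 2N and N ≥ 2.  Given a colouring c' of G ∖ S we
-- extend it to a colouring of G whose monochromatic K_(N+1) all come from
-- monochromatic K_N in G ∖ S.  Split S, in order, into a first part (side
-- true) and a second part (side false) of at most N vertices each, and number
-- each part by indices below N; this gives each vertex of S a code
-- (side, index), injectively.  An edge from x ∈ S to the outside gets colour
-- side x, an edge inside one part of side s gets colour not s, and an edge
-- between the parts gets colour "the indices differ" (the gadget colouring).
--  * The gadget colouring of codes has no monochromatic K_(N+1) (pigeonhole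
--    on the N indices), so a monochromatic K_(N+1) of G is not inside S.
--  * If it has a vertex outside S, each of its S-vertices has side equal to
--    its colour b, while two S-vertices of side b span colour not b; so at
--    most one vertex lies in S, and removing it leaves a monochromatic K_N
--    of G ∖ S, coloured by c'.

open import Defs
open import Data.Nat using (ℕ; _≤_; _∸_; _*_)
open import Data.Fin.Subset using (Subset; ∣_∣)

open import Data.Nat using (zero; suc; _<_; _+_; _≡ᵇ_; _<?_; z≤n; s≤s; s<s)
import Data.Nat.Properties as ℕₚ
open import Data.Fin using (Fin; punchIn; fromℕ<)
import Data.Fin.Properties as Finₚ
open import Data.Fin.Subset using (_∈_; _∉_)
open import Data.Fin.Subset.Properties using (_∈?_)
open import Data.Vec using (_∷_; here; there)
open import Data.Bool using (Bool; true; false; not; T; _≟_)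
open import Data.Bool.Properties using (¬-not; not-¬)
open import Data.Empty using (⊥; ⊥-elim)
open import Data.Product using (_×_; _,_; proj₁; proj₂; ∃)
open import Function.Definitions using (Injective)
open import Relation.Nullary using (¬_; Dec; yes; no; ¬?)
open import Relation.Nullary.Decidable using (decidable-stable)
open import Relation.Binary.PropositionalEquality
  using (_≡_; _≢_; refl; cong; cong₂; subst; subst₂; trans; ≢-sym; module ≡-Reasoning)
  renaming (sym to ≡-sym)

rank : ∀ {m} → Subset m → Fin m → ℕ
rank (_ ∷ p)     Fin.zero    = 0
rank (true ∷ p)  (Fin.suc x) = suc (rank p x)
rank (false ∷ p) (Fin.suc x) = rank p x

rank< : ∀ {m} {p : Subset m} {x} → x ∈ p → rank p x < ∣ p ∣
rank< here                    = s≤s z≤n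
rank< (there {y = true} x∈p)  = s<s (rank< x∈p)
rank< (there {y = false} x∈p) = rank< x∈p

rank-injective : ∀ {m} {p : Subset m} {x y} → x ∈ p → y ∈ p →
                 rank p x ≡ rank p y → x ≡ y
rank-injective here                    here                 _  = refl
rank-injective here                    (there {y = true} _) ()
rank-injective (there {y = true} _)    here                 ()
rank-injective (there {y = true} x∈p) (there y∈p) eq =
  cong Fin.suc (rank-injective x∈p y∈p (ℕₚ.suc-injective eq))
rank-injective (there {y = false} x∈p) (there y∈p) eq =
  cong Fin.suc (rank-injective x∈p y∈p eq)

halve : ℕ → ℕ → Bool × ℕ
halve N r with r <? N
... | yes _ = true , r
... | no  _ = false , r ∸ N

halve-index< : ∀ N {r} → r < N + N → proj₂ (halve N r) < N
halve-index< N {r} r<2N with r <? N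
... | yes r<N = r<N
... | no  r≮N = subst (r ∸ N <_) (ℕₚ.m+n∸m≡n N N) (ℕₚ.∸-monoˡ-< r<2N (ℕₚ.≮⇒≥ r≮N))

halve-injective : ∀ N {r r'} → halve N r ≡ halve N r' → r ≡ r'
halve-injective N {r} {r'} eq with r <? N | r' <? N
... | yes _   | yes _    = cong proj₂ eq
... | yes _   | no  _    with () ← cong proj₁ eq
... | no  _   | yes _    with () ← cong proj₁ eq
... | no  r≮N | no  r'≮N = ℕₚ.∸-cancelʳ-≡ (ℕₚ.≮⇒≥ r≮N) (ℕₚ.≮⇒≥ r'≮N) (cong proj₂ eq)

≡ᵇ-sym : ∀ a a' → (a ≡ᵇ a') ≡ (a' ≡ᵇ a)
≡ᵇ-sym zero    zero     = refl
≡ᵇ-sym zero    (suc a') = refl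
≡ᵇ-sym (suc a) zero     = refl
≡ᵇ-sym (suc a) (suc a') = ≡ᵇ-sym a a'

gadget : Bool × ℕ → Bool × ℕ → Bool
gadget (true  , _) (true  , _)  = false
gadget (false , _) (false , _)  = true
gadget (true  , a) (false , a') = not (a ≡ᵇ a')
gadget (false , a) (true  , a') = not (a ≡ᵇ a')

gadget-sym : ∀ u v → gadget u v ≡ gadget v u
gadget-sym (true  , _) (true  , _)  = refl
gadget-sym (false , _) (false , _)  = refl
gadget-sym (true  , a) (false , a') = cong not (≡ᵇ-sym a a')
gadget-sym (false , a) (true  , a') = cong not (≡ᵇ-sym a a')

gadget-same : ∀ u v → proj₁ u ≡ proj₁ v → gadget u v ≡ not (proj₁ u)
gadget-same (true  , _) (true  , _) refl = refl
gadget-same (false , _) (false , _) refl = refl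

gadget-cross : ∀ {s t} → s ≢ t → ∀ a a' → gadget (s , a) (t , a') ≡ not (a ≡ᵇ a')
gadget-cross {true}  {true}  s≢t _ _ = ⊥-elim (s≢t refl)
gadget-cross {true}  {false} _   _ _ = refl
gadget-cross {false} {true}  _   _ _ = refl
gadget-cross {false} {false} s≢t _ _ = ⊥-elim (s≢t refl)

cross-false⇒≡ : ∀ {s t} → s ≢ t → ∀ a a' → gadget (s , a) (t , a') ≡ false → a ≡ a'
cross-false⇒≡ s≢t a a' eq with a ≡ᵇ a' in a≡ᵇa' | gadget-cross s≢t a a'
... | true  | _  = ℕₚ.≡ᵇ⇒≡ a a' (subst T (≡-sym a≡ᵇa') _)
... | false | eq' with () ← trans (≡-sym eq') eq

≡⇒cross-false : ∀ {s t} → s ≢ t → ∀ a → gadget (s , a) (t , a) ≡ false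
≡⇒cross-false s≢t a with a ≡ᵇ a in a≡ᵇa | gadget-cross s≢t a a
... | true  | eq = eq
... | false | _  with () ← subst T a≡ᵇa (ℕₚ.≡⇒≡ᵇ a a refl)

third : ∀ {n} (i j : Fin (3 + n)) → ∃ λ k → k ≢ i × k ≢ j
third Fin.zero                Fin.zero              = Fin.suc Fin.zero , (λ ()) , (λ ())
third Fin.zero                (Fin.suc Fin.zero)    = Fin.suc (Fin.suc Fin.zero) , (λ ()) , (λ ())
third Fin.zero                (Fin.suc (Fin.suc _)) = Fin.suc Fin.zero , (λ ()) , (λ ())
third (Fin.suc Fin.zero)      Fin.zero              = Fin.suc (Fin.suc Fin.zero) , (λ ()) , (λ ())
third (Fin.suc (Fin.suc _))   Fin.zero              = Fin.suc Fin.zero , (λ ()) , (λ ())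
third (Fin.suc _)             (Fin.suc _)           = Fin.zero , (λ ()) , (λ ())

-- By pigeonhole two codes share an index, so they lie on
-- different sides and the colour is false; then any two codes on different
-- sides share an index, and a third code collides with one of the first two.
gadget-no-clique : ∀ {N} → 2 ≤ N → (p : Fin (suc N) → Bool × ℕ) → Injective _≡_ _≡_ p →
                   (∀ k → proj₂ (p k) < N) →
                   ∀ b → ¬ (∀ k l → k ≢ l → gadget (p k) (p l) ≡ b)
gadget-no-clique {suc (suc _)} (s≤s (s≤s z≤n)) p p-inj index< b mono
  with i , j , i<j , same ← Finₚ.pigeonhole ℕₚ.≤-refl (λ k → fromℕ< (index< k))
  with k , k≢i , k≢j ← third i j = split (side k ≟ side i)
  where
  side : _ → Bool
  side k = proj₁ (p k)
  index : _ → ℕ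
  index k = proj₂ (p k)

  i≢j : i ≢ j
  i≢j = Finₚ.<⇒≢ i<j

  index-ij : index i ≡ index j
  index-ij = Finₚ.fromℕ<-injective _ _ (index< i) (index< j) same

  sides-ij : side i ≢ side j
  sides-ij eq = i≢j (p-inj (cong₂ _,_ eq index-ij))

  b≡false : b ≡ false
  b≡false = trans (≡-sym (mono i j i≢j))
                  (subst (λ a → gadget (p i) (side j , a) ≡ false) index-ij
                         (≡⇒cross-false sides-ij (index i)))

  cross : ∀ u v → u ≢ v → side u ≢ side v → index u ≡ index v
  cross u v u≢v sides = cross-false⇒≡ sides (index u) (index v) (trans (mono u v u≢v) b≡false)

  -- k shares its side with u and, being across from v, its index with v.
  collide : ∀ u v → k ≢ u → k ≢ v → side k ≡ side u → side u ≢ side v →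
            index u ≡ index v → ⊥
  collide u v k≢u k≢v side-ku sides-uv index-uv =
    k≢u (p-inj (cong₂ _,_ side-ku
      (trans (cross k v k≢v (λ e → sides-uv (trans (≡-sym side-ku) e))) (≡-sym index-uv))))

  split : Dec (side k ≡ side i) → ⊥
  split (yes side-ki) = collide i j k≢i k≢j side-ki sides-ij index-ij
  split (no side-k≢i) = collide j i k≢j k≢i side-kj (≢-sym sides-ij) (≡-sym index-ij)
    where
    side-kj : side k ≡ side j
    side-kj = trans (¬-not side-k≢i) (≡-sym (¬-not (≢-sym sides-ij)))

-- A vertex known to avoid S, as a vertex of G ∖ S (with the membership proof
-- chosen by the decision procedure, so that it matches the colouring below).
outside : ∀ {m} {S : Subset m} (x : Fin m) → x ∉ S → Remaining S
outside {S = S} x x∉S with x ∈? S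
... | yes x∈S = ⊥-elim (x∉S x∈S)
... | no  x∉S' = x , x∉S'

outside-vertex : ∀ {m} {S : Subset m} x (x∉S : x ∉ S) → proj₁ (outside {S = S} x x∉S) ≡ x
outside-vertex {S = S} x x∉S with x ∈? S
... | yes x∈S = ⊥-elim (x∉S x∈S)
... | no  _   = refl

restrict : ∀ {m N} {G : FinGraph m} {S : Subset m} (c : Colouring (Fin m))
           (c' : Colouring (Remaining S)) →
           (∀ x y x∉S y∉S → col c x y ≡ col c' (outside x x∉S) (outside y y∉S)) →
           ((b , f , _) : MonoK G c (suc N)) →
           (k0 : Fin (suc N)) → (∀ l → l ≢ k0 → f l ∉ S) → MonoK (G ∖ S) c' N
restrict {G = G} {S = S} c c' agree (b , f , f-inj , mono) k0 avoids = b , g , g-inj , g-mono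
  where
  e : Fin _ → Fin _
  e = punchIn k0
  avoid : ∀ k → f (e k) ∉ S
  avoid k = avoids (e k) (Finₚ.punchInᵢ≢i k0 k)
  g : Fin _ → Remaining _
  g k = outside (f (e k)) (avoid k)
  vertex : ∀ k → proj₁ (g k) ≡ f (e k)
  vertex k = outside-vertex (f (e k)) (avoid k)

  g-inj : Injective _≡_ _≡_ g
  g-inj {i} {j} eq = Finₚ.punchIn-injective k0 i j
    (f-inj (trans (≡-sym (vertex i)) (trans (cong proj₁ eq) (vertex j))))

  g-mono : ∀ i j → i ≢ j → Adj (G ∖ _) (g i) (g j) × col c' (g i) (g j) ≡ b
  g-mono i j i≢j with adj , colour ← mono (e i) (e j) (λ eq → i≢j (Finₚ.punchIn-injective k0 i j eq)) =
    subst₂ (Adj G) (≡-sym (vertex i)) (≡-sym (vertex j)) adj ,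
    trans (≡-sym (agree _ _ (avoid i) (avoid j))) colour

module Extension {m : ℕ} (N : ℕ) (S : Subset m) (c' : Colouring (Remaining S)) where

  code : Fin m → Bool × ℕ
  code x = halve N (rank S x)

  side : Fin m → Bool
  side x = proj₁ (code x)

  colour : Fin m → Fin m → Bool
  colour x y with x ∈? S | y ∈? S
  ... | no  x∉S | no  y∉S = col c' (x , x∉S) (y , y∉S)
  ... | yes _   | no  _   = side x
  ... | no  _   | yes _   = side y
  ... | yes _   | yes _   = gadget (code x) (code y)

  colour-sym : ∀ x y → colour x y ≡ colour y x
  colour-sym x y with x ∈? S | y ∈? S
  ... | no  x∉S | no  y∉S = col-sym c' (x , x∉S) (y , y∉S)
  ... | yes _   | no  _   = refl
  ... | no  _   | yes _   = refl
  ... | yes _   | yes _   = gadget-sym (code x) (code y)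

  extended : Colouring (Fin m)
  extended = record { col = colour ; col-sym = colour-sym }

  colour-outside : ∀ x y x∉S y∉S → colour x y ≡ col c' (outside x x∉S) (outside y y∉S)
  colour-outside x y x∉S y∉S with x ∈? S | y ∈? S
  ... | no  _   | no  _   = refl
  ... | yes x∈S | _       = ⊥-elim (x∉S x∈S)
  ... | no  _   | yes y∈S = ⊥-elim (y∉S y∈S)

  colour-boundary : ∀ {x y} → x ∈ S → y ∉ S → colour x y ≡ side x
  colour-boundary {x} {y} x∈S y∉S with x ∈? S | y ∈? S
  ... | yes _   | no  _   = refl
  ... | no  x∉S | _       = ⊥-elim (x∉S x∈S)
  ... | yes _   | yes y∈S = ⊥-elim (y∉S y∈S)

  colour-inside : ∀ {x y} → x ∈ S → y ∈ S → colour x y ≡ gadget (code x) (code y)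
  colour-inside {x} {y} x∈S y∈S with x ∈? S | y ∈? S
  ... | yes _   | yes _   = refl
  ... | no  x∉S | _       = ⊥-elim (x∉S x∈S)
  ... | yes _   | no  y∉S = ⊥-elim (y∉S y∈S)

  -- In a clique of colour b with a vertex outside S, every S-vertex has side
  -- b; two such vertices would span colour not b, so there is at most one.
  lonely : ∀ {k} b (f : Fin k → Fin m) → (∀ i j → i ≢ j → colour (f i) (f j) ≡ b) →
           ∀ {k0 j} → f k0 ∈ S → f j ∉ S → ∀ l → l ≢ k0 → f l ∉ S
  lonely b f mono {k0} {j} fk0∈S fj∉S l l≢k0 fl∈S = not-¬ refl (begin
      b                                  ≡⟨ ≡-sym (mono k0 l (≢-sym l≢k0)) ⟩
      colour (f k0) (f l)                ≡⟨ colour-inside fk0∈S fl∈S ⟩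
      gadget (code (f k0)) (code (f l))  ≡⟨ gadget-same _ _ (trans (side≡b fk0∈S) (≡-sym (side≡b fl∈S))) ⟩
      not (side (f k0))                  ≡⟨ cong not (side≡b fk0∈S) ⟩
      not b                              ∎)
    where
    open ≡-Reasoning
    side≡b : ∀ {i} → f i ∈ S → side (f i) ≡ b
    side≡b {i} fi∈S = trans (≡-sym (colour-boundary fi∈S fj∉S))
                            (mono i j (λ { refl → fj∉S fi∈S }))

  -- If N ≥ 2 and |S| ≤ 2N, no monochromatic K_(N+1) lies inside S: its codes
  -- would form a monochromatic K_(N+1) of the gadget colouring.
  not-inside : 2 ≤ N → ∣ S ∣ ≤ 2 * N → ∀ b (f : Fin (suc N) → Fin m) →
               Injective _≡_ _≡_ f → (∀ i j → i ≢ j → colour (f i) (f j) ≡ b) →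
               ¬ (∀ k → f k ∈ S)
  not-inside 2≤N |S|≤2N b f f-inj mono in-S =
    gadget-no-clique 2≤N codes codes-inj index< b codes-mono
    where
    codes : Fin (suc N) → Bool × ℕ
    codes k = code (f k)

    codes-inj : Injective _≡_ _≡_ codes
    codes-inj {i} {j} eq = f-inj (rank-injective (in-S i) (in-S j) (halve-injective N eq))

    index< : ∀ k → proj₂ (codes k) < N
    index< k = halve-index< N (ℕₚ.<-≤-trans (rank< (in-S k))
                 (subst (∣ S ∣ ≤_) (cong (N +_) (ℕₚ.+-identityʳ N)) |S|≤2N))

    codes-mono : ∀ k l → k ≢ l → gadget (codes k) (codes l) ≡ b
    codes-mono k l k≢l = trans (≡-sym (colour-inside (in-S k) (in-S l))) (mono k l k≢l)

  isolated : 2 ≤ N → ∣ S ∣ ≤ 2 * N → ∀ b (f : Fin (suc N) → Fin m) →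
             Injective _≡_ _≡_ f → (∀ i j → i ≢ j → colour (f i) (f j) ≡ b) →
             ∃ λ k0 → ∀ l → l ≢ k0 → f l ∉ S
  isolated 2≤N |S|≤2N b f f-inj mono with Finₚ.any? (λ k → f k ∈? S)
  ... | no none-in = Fin.zero , λ l _ fl∈S → none-in (l , fl∈S)
  ... | yes (k0 , fk0∈S) with Finₚ.any? (λ k → ¬? (f k ∈? S))
  ...   | yes (j , fj∉S) = k0 , lonely b f mono fk0∈S fj∉S
  ...   | no none-out    = ⊥-elim (not-inside 2≤N |S|≤2N b f f-inj mono in-S)
    where
    in-S : ∀ k → f k ∈ S
    in-S k = decidable-stable (f k ∈? S) (λ fk∉S → none-out (k , fk∉S))

corollary4 : (n m : ℕ) → 3 ≤ n → (G : FinGraph m) → G ⟶K n →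
    (S : Subset m) → ∣ S ∣ ≤ 2 * n ∸ 2 → (G ∖ S) ⟶K (n ∸ 1)
corollary4 (suc N) m (s≤s 2≤N) G G⟶Kn S |S|≤2n-2 c' = restricted (G⟶Kn extended)
  where
  open Extension N S c'

  |S|≤2N : ∣ S ∣ ≤ 2 * N
  |S|≤2N = subst (λ t → ∣ S ∣ ≤ t ∸ 2) (ℕₚ.*-suc 2 N) |S|≤2n-2

  restricted : MonoK G extended (suc N) → MonoK (G ∖ S) c' N
  restricted clique@(b , f , f-inj , mono)
    with k0 , others-outside ← isolated 2≤N |S|≤2N b f f-inj (λ i j i≢j → proj₂ (mono i j i≢j))
    = restrict {G = G} extended c' colour-outside clique k0 others-outside
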